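{- Let $m,n \geq 2$ be integers. The graph $K_m \times K_n$ admits a $C_4$-decomposition if and only if at least one of the following holds: (1) $n \equiv 0 \pmod 4$ and $m$ is odd; (2) $m \equiv 0 \pmod 4$ and $n$ is odd; (3) $m \equiv 1 \pmod 4$ or $n \equiv 1 \pmod 4$.
   Context: All graphs are simple and finite. $K_m$ denotes the complete graph on $m$ vertices and $C_k$ the cycle of length $k$. For graphs $G$ and $H$, the tensor product $G \times H$ has vertex set $V(G)\times V(H)$, with $(g_1,h_1)$ adjacent to $(g_2,h_2)$ iff $g_1g_2 \in E(G)$ and $h_1h_2 \in E(H)$. A graph $G$ admits a $C_k$-decomposition (written $C_k \mid G$) if its edge set can be partitioned into the edge sets of subgraphs each isomorphic to $C_k$. -}

module Defs where

open import Level using (0ℓ)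
open import Data.Nat using (ℕ)
open import Data.Fin using (Fin; zero; suc)
open import Data.List using (List; length)
open import Data.Product using (Σ; ∃; _×_; _,_)
open import Data.Sum using (_⊎_)
open import Relation.Binary.PropositionalEquality using (_≡_; _≢_)

record Graph : Set₁ where
  field
    V   : Set
    Adj : V → V → Set
open Graph public

K : ℕ → Graph
K m = record { V = Fin m ; Adj = λ i j → i ≢ j }

_⊗_ : Graph → Graph → Graph
G ⊗ H = record
  { V   = V G × V H
  ; Adj = λ { (g₁ , h₁) (g₂ , h₂) → Adj G g₁ g₂ × Adj H h₁ h₂ } }

next : Fin 4 → Fin 4
next zero = suc zero
next (suc zero) = suc (suc zero)
next (suc (suc zero)) = suc (suc (suc zero))
next (suc (suc (suc zero))) = zero

record Cycle4 (G : Graph) : Set where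
  field
    vert     : Fin 4 → V G
    distinct : ∀ i j → vert i ≡ vert j → i ≡ j
    edges    : ∀ i → Adj G (vert i) (vert (next i))
open Cycle4 public

EdgeOf : {G : Graph} → Cycle4 G → V G → V G → Set
EdgeOf c x y = ∃ λ i →
  (vert c i ≡ x × vert c (next i) ≡ y) ⊎ (vert c i ≡ y × vert c (next i) ≡ x)

C4Decomposable : Graph → Set
C4Decomposable G = Σ (List (Cycle4 G)) λ cs →
  ∀ x y → Adj G x y →
    (∃ λ (k : Fin (length cs)) → EdgeOf (Data.List.lookup cs k) x y)
    × (∀ (k k′ : Fin (length cs)) →
         EdgeOf (Data.List.lookup cs k) x y →
         EdgeOf (Data.List.lookup cs k′) x y → k ≡ k′)

-- Necessity is a count. Each 4-cycle through a vertex uses two of its (m − 1)(n − 1)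
-- edges, so that degree is even; and the m n (m − 1)(n − 1) arcs of K_m × K_n come eight
-- to a cycle. Modulo 8 these two conditions leave exactly the admissible residues.
--
-- Sufficiency composes decompositions, which lift along G × −. If m is odd and 4 ∣ n,
-- K_n splits into paths P₃ and K_m × P₃ into squares, by pairing up the neighbours of
-- each vertex of K_m. If m ≡ 1 (mod 4), K_n splits into edges, and K_m × K₂ into squares:
-- K_m is t copies of K₅ through a common point plus complete joins between the blocks,
-- K₅ × K₂ is covered by five cyclically shifted squares, and each join becomes a K₄,₄ in
-- K_m × K₂ which splits into four squares. The remaining cases follow by symmetry.

module Submission where

open import Defs
open import Axiom.UniquenessOfIdentityProofs.WithK using (uip)
open import Data.Empty using (⊥-elim)
open import Data.Fin using (Fin; zero; suc; cast; punchIn; punchOut; toℕ; fromℕ<; combine; remQuot)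
import Data.Fin as Fin
open import Data.Fin.Patterns using (0F; 1F; 2F; 3F)
open import Data.Fin.Properties
  using (+↔⊎; *↔×; 1↔⊤; all?; any?; cast-involutive; cantor-schröder-bernstein; toℕ-fromℕ<;
         punchInᵢ≢i; punchIn-punchOut; punchIn-injective; punchOut-cong; punchOut-punchIn;
         combine-injectiveʳ; combine-remQuot; remQuot-combine; <-cmp; <-irrelevant; <-irrefl; <-asym)
open import Data.List using (List; length; lookup; tabulate)
open import Data.List.Properties using (length-tabulate; lookup-tabulate)
open import Data.Nat using (ℕ; zero; suc; _+_; _*_; _%_; _/_; _≤_; NonZero)
import Data.Nat as ℕ
open import Data.Nat.DivMod
  using (_mod_; m≡m%n+[m/n]*n; %-distribˡ-+; %-distribˡ-*; m∣n⇒o%n%m≡o%m; m%n%n≡m%n; m%n<n; m*n%n≡0)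
open import Data.Nat.Divisibility using (_∣_; divides)
open import Data.Nat.Properties using (*-assoc; ≤⇒≯; ≤-refl)
open import Data.Product using (Σ; ∃; _×_; _,_; proj₁; proj₂; swap)
open import Data.Product.Algebra using (×-cong; ×-comm; Σ-assoc)
open import Data.Product.Function.Dependent.Propositional using (Σ-↔)
open import Data.Product.Properties using (≡-dec)
open import Data.Sum using (_⊎_; inj₁; inj₂; [_,_]′) renaming (swap to ⊎-swap)
open import Data.Sum.Algebra using (⊎-cong)
open import Data.Sum.Properties using (inj₂-injective)
open import Data.Unit using (⊤; tt)
open import Data.Vec using ([]; _∷_) renaming (lookup to lookupᵛ)
open import Function using (_∘_)
open import Function.Bundles using (_↔_; _⇔_; mk⇔; Inverse; Injection; mk↔ₛ′)
open import Function.Properties.Inverse using (↔-refl; ↔-sym; ↔-trans; ↔⇒↣)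
open import Function.Related.Propositional using (module EquationalReasoning)
open import Relation.Binary.Definitions using (DecidableEquality; tri<; tri≈; tri>)
open import Relation.Binary.PropositionalEquality
open import Relation.Nullary using (¬_; Dec; yes; no)
open import Relation.Nullary.Decidable using (toWitness; True; map′; ¬?; _×-dec_; _⊎-dec_; _→-dec_)
open import Relation.Unary using (Decidable; Irrelevant)

↔-injective : ∀ {A B : Set} (A↔B : A ↔ B) {x y} → Inverse.to A↔B x ≡ Inverse.to A↔B y → x ≡ y
↔-injective A↔B = Injection.injective (↔⇒↣ A↔B)

Fin2-injective : ∀ {A : Set} (f : Fin 2 → A) → f 0F ≢ f 1F → ∀ {l l′} → f l ≡ f l′ → l ≡ l′
Fin2-injective f f₀≢f₁ {0F} {0F} _ = refl
Fin2-injective f f₀≢f₁ {0F} {1F} e = ⊥-elim (f₀≢f₁ e)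
Fin2-injective f f₀≢f₁ {1F} {0F} e = ⊥-elim (f₀≢f₁ (sym e))
Fin2-injective f f₀≢f₁ {1F} {1F} _ = refl

Symmetric : Graph → Set
Symmetric G = ∀ {x y} → Adj G x y → Adj G y x

Loopless : Graph → Set
Loopless G = ∀ {x} → ¬ Adj G x x

Complete : Set → Graph
Complete A = record { V = A ; Adj = λ x y → x ≢ y }

Complete-symmetric : ∀ A → Symmetric (Complete A)
Complete-symmetric _ x≢y = x≢y ∘ sym

Complete-loopless : ∀ A → Loopless (Complete A)
Complete-loopless _ x≢x = x≢x refl

⊗-symmetric : ∀ {G H} → Symmetric G → Symmetric H → Symmetric (G ⊗ H)
⊗-symmetric sym-G sym-H (gg′ , hh′) = sym-G gg′ , sym-H hh′

⊗-loopless : ∀ {G} H → Loopless G → Loopless (G ⊗ H)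
⊗-loopless _ loopless-G (gg , _) = loopless-G gg

_∩_ : (H : Graph) → (V H → V H → Set) → Graph
H ∩ R = record { V = V H ; Adj = λ x y → Adj H x y × R x y }

C₄ : Graph
C₄ = record { V = Fin 4 ; Adj = λ i j → j ≡ next i ⊎ i ≡ next j }

P₃ : Graph
P₃ = record { V = Fin 3 ; Adj = λ i j → i ≢ j × (i ≡ 0F ⊎ j ≡ 0F) }

P₃-symmetric : Symmetric P₃
P₃-symmetric (i≢j , centre) = i≢j ∘ sym , ⊎-swap centre

record Embedding (F H : Graph) : Set where
  field
    map       : V F → V H
    injective : ∀ {a b} → map a ≡ map b → a ≡ b
    adjacent  : ∀ {a b} → Adj F a b → Adj H (map a) (map b)
open Embedding public

_∘ᴱ_ : ∀ {F G H} → Embedding G H → Embedding F G → Embedding F H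
e ∘ᴱ d = record
  { map       = map e ∘ map d
  ; injective = injective d ∘ injective e
  ; adjacent  = adjacent e ∘ adjacent d
  }

record EdgeImage {F H : Graph} (e : Embedding F H) (x y : V H) : Set where
  constructor image
  field
    src tgt : V F
    edge    : Adj F src tgt
    src↦    : map e src ≡ x
    tgt↦    : map e tgt ≡ y

-- H is the edge-disjoint union of the copies embedding p of F: piece xy names the copy
-- containing the edge xy, and no other copy contains it.
record Decomposition (F H : Graph) : Set₁ where
  field
    Piece        : Set
    #pieces      : ℕ
    enumeration  : Fin #pieces ↔ Piece
    embedding    : Piece → Embedding F H
    piece        : ∀ {x y} → Adj H x y → Piece
    covers       : ∀ {x y} (xy : Adj H x y) → EdgeImage (embedding (piece xy)) x y
    piece-unique : ∀ p {a b} → Adj F a b →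
                   (xy : Adj H (map (embedding p) a) (map (embedding p) b)) → piece xy ≡ p

  unique : ∀ {x y} (xy : Adj H x y) p → EdgeImage (embedding p) x y → piece xy ≡ p
  unique xy p (image a b ab refl refl) = piece-unique p ab xy

  covers-endpoints : ∀ p {a b} (ab : Adj F a b) (xy : Adj H (map (embedding p) a) (map (embedding p) b)) →
                     EdgeImage.src (covers xy) ≡ a × EdgeImage.tgt (covers xy) ≡ b
  covers-endpoints p ab xy with piece xy | piece-unique p ab xy | covers xy
  ... | _ | refl | image _ _ _ a↦ b↦ = injective (embedding p) a↦ , injective (embedding p) b↦

infix 4 _≅_

record _≅_ (F H : Graph) : Set where
  field
    vertices  : V F ↔ V H
  open Inverse vertices public
  field
    to-adj    : ∀ {a b} → Adj F a b → Adj H (to a) (to b)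
    from-adj  : ∀ {x y} → Adj H x y → Adj F (from x) (from y)

≅⇒Decomposition : ∀ {F H} → F ≅ H → Decomposition F H
≅⇒Decomposition {F} {H} F≅H = record
  { Piece        = ⊤
  ; #pieces      = 1
  ; enumeration  = 1↔⊤
  ; embedding    = λ _ → record
      { map = to ; injective = ↔-injective vertices ; adjacent = to-adj }
  ; piece        = λ _ → tt
  ; covers       = λ {x} {y} xy → image (from x) (from y) (from-adj xy) (strictlyInverseˡ x) (strictlyInverseˡ y)
  ; piece-unique = λ _ _ _ → refl
  }
  where open _≅_ F≅H

Complete-cong : ∀ {A B} → A ↔ B → Complete A ≅ Complete B
Complete-cong A↔B = record
  { vertices  = A↔B
  ; to-adj    = λ a≢b → a≢b ∘ ↔-injective A↔B
  ; from-adj  = λ x≢y → x≢y ∘ ↔-injective (↔-sym A↔B)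
  }

⊗-comm : ∀ G H → G ⊗ H ≅ H ⊗ G
⊗-comm G H = record
  { vertices  = ×-comm (V G) (V H)
  ; to-adj    = swap
  ; from-adj  = swap
  }

⊗-congˡ : ∀ {F F′} H → F ≅ F′ → F ⊗ H ≅ F′ ⊗ H
⊗-congˡ H F≅F′ = record
  { vertices  = ×-cong vertices ↔-refl
  ; to-adj    = λ (ab , xy) → to-adj ab , xy
  ; from-adj  = λ (ab , xy) → from-adj ab , xy
  }
  where open _≅_ F≅F′

Decomposition-trans : ∀ {F G H} → Decomposition F G → Decomposition G H → Decomposition F H
Decomposition-trans {F} {G} {H} D E = record
  { Piece        = E.Piece × D.Piece
  ; #pieces      = E.#pieces * D.#pieces
  ; enumeration  = ↔-trans *↔× (×-cong E.enumeration D.enumeration)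
  ; embedding    = embedding
  ; piece        = λ xy → E.piece xy , D.piece (EdgeImage.edge (E.covers xy))
  ; covers       = covers
  ; piece-unique = piece-unique
  }
  where
  module D = Decomposition D
  module E = Decomposition E

  embedding : E.Piece × D.Piece → Embedding F H
  embedding (p , q) = E.embedding p ∘ᴱ D.embedding q

  covers : ∀ {x y} (xy : Adj H x y) → EdgeImage (embedding (E.piece xy , D.piece (EdgeImage.edge (E.covers xy)))) x y
  covers xy with E.covers xy
  ... | image a b ab a↦ b↦ with D.covers ab
  ...   | image c d cd c↦ d↦ = image c d cd (trans (cong (map (E.embedding (E.piece xy))) c↦) a↦)
                                            (trans (cong (map (E.embedding (E.piece xy))) d↦) b↦)

  piece-unique : ∀ pq {c d} → Adj F c d → (xy : Adj H (map (embedding pq) c) (map (embedding pq) d)) →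
                 (E.piece xy , D.piece (EdgeImage.edge (E.covers xy))) ≡ pq
  piece-unique (p , q) {c} {d} cd xy =
    cong₂ _,_ (E.piece-unique p (adjacent (D.embedding q) cd) xy)
              (D.unique _ q (image c d cd (sym (proj₁ endpoints)) (sym (proj₂ endpoints))))
    where endpoints = E.covers-endpoints p (adjacent (D.embedding q) cd) xy

Decomposition-⊗ : ∀ {F H} (G : Graph) → Decomposition F H → Decomposition (G ⊗ F) (G ⊗ H)
Decomposition-⊗ {F} {H} G D = record
  { Piece        = D.Piece
  ; #pieces      = D.#pieces
  ; enumeration  = D.enumeration
  ; embedding    = embedding
  ; piece        = λ xy → D.piece (proj₂ xy)
  ; covers       = covers
  ; piece-unique = λ p ab xy → D.piece-unique p (proj₂ ab) (proj₂ xy)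
  }
  where
  module D = Decomposition D

  embedding : D.Piece → Embedding (G ⊗ F) (G ⊗ H)
  embedding p = record
    { map       = λ (g , a) → g , map (D.embedding p) a
    ; injective = λ e → cong₂ _,_ (cong proj₁ e) (injective (D.embedding p) (cong proj₂ e))
    ; adjacent  = λ (gg′ , ab) → gg′ , adjacent (D.embedding p) ab
    }

  covers : ∀ {x y} (xy : Adj (G ⊗ H) x y) → EdgeImage (embedding (D.piece (proj₂ xy))) x y
  covers {g , _} {g′ , _} (gg′ , xy) with D.covers xy
  ... | image a b ab a↦ b↦ = image (g , a) (g′ , b) (gg′ , ab) (cong (g ,_) a↦) (cong (g′ ,_) b↦)

Decomposition-swap : ∀ {F G H} → Decomposition F (G ⊗ H) → Decomposition F (H ⊗ G)
Decomposition-swap {G = G} {H} D = Decomposition-trans D (≅⇒Decomposition (⊗-comm G H))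

Decomposition-split : ∀ {F H} (R : V H → V H → Set) → (∀ x y → Dec (R x y)) →
                      Decomposition F (H ∩ R) → Decomposition F (H ∩ λ x y → ¬ R x y) → Decomposition F H
Decomposition-split {F} {H} R R? D₁ D₂ = record
  { Piece        = D₁.Piece ⊎ D₂.Piece
  ; #pieces      = D₁.#pieces + D₂.#pieces
  ; enumeration  = ↔-trans +↔⊎ (⊎-cong D₁.enumeration D₂.enumeration)
  ; embedding    = embedding
  ; piece        = piece
  ; covers       = covers
  ; piece-unique = piece-unique
  }
  where
  module D₁ = Decomposition D₁
  module D₂ = Decomposition D₂

  forget : ∀ {S} → Embedding F (H ∩ S) → Embedding F H
  forget e = record { map = map e ; injective = injective e ; adjacent = proj₁ ∘ adjacent e }

  embedding : D₁.Piece ⊎ D₂.Piece → Embedding F H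
  embedding (inj₁ p) = forget (D₁.embedding p)
  embedding (inj₂ p) = forget (D₂.embedding p)

  piece : ∀ {x y} → Adj H x y → D₁.Piece ⊎ D₂.Piece
  piece {x} {y} xy with R? x y
  ... | yes r = inj₁ (D₁.piece (xy , r))
  ... | no ¬r = inj₂ (D₂.piece (xy , ¬r))

  covers : ∀ {x y} (xy : Adj H x y) → EdgeImage (embedding (piece xy)) x y
  covers {x} {y} xy with R? x y
  ... | yes r = let image a b ab a↦ b↦ = D₁.covers (xy , r) in image a b ab a↦ b↦
  ... | no ¬r = let image a b ab a↦ b↦ = D₂.covers (xy , ¬r) in image a b ab a↦ b↦

  piece-unique : ∀ p {a b} → Adj F a b → (xy : Adj H (map (embedding p) a) (map (embedding p) b)) → piece xy ≡ p
  piece-unique (inj₁ p) {a} {b} ab xy with R? (map (D₁.embedding p) a) (map (D₁.embedding p) b)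
  ... | yes r = cong inj₁ (D₁.piece-unique p ab (xy , r))
  ... | no ¬r = ⊥-elim (¬r (proj₂ (adjacent (D₁.embedding p) ab)))
  piece-unique (inj₂ p) {a} {b} ab xy with R? (map (D₂.embedding p) a) (map (D₂.embedding p) b)
  ... | yes r = ⊥-elim (proj₂ (adjacent (D₂.embedding p) ab) r)
  ... | no ¬r = cong inj₂ (D₂.piece-unique p ab (xy , ¬r))

cycle : ∀ {H} → Embedding C₄ H → Cycle4 H
cycle e = record { vert = map e ; distinct = λ _ _ → injective e ; edges = λ _ → adjacent e (inj₁ refl) }

edgeOf : ∀ {H} (e : Embedding C₄ H) {x y} → EdgeImage e x y → EdgeOf (cycle e) x y
edgeOf e (image a _ (inj₁ refl) a↦ b↦) = a , inj₁ (a↦ , b↦)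
edgeOf e (image _ b (inj₂ refl) a↦ b↦) = b , inj₂ (b↦ , a↦)

edgeImage : ∀ {H} (e : Embedding C₄ H) {x y} → EdgeOf (cycle e) x y → EdgeImage e x y
edgeImage e (i , inj₁ (i↦ , next↦)) = image i (next i) (inj₁ refl) i↦ next↦
edgeImage e (i , inj₂ (i↦ , next↦)) = image (next i) i (inj₂ refl) next↦ i↦

Decomposition⇒C4Decomposable : ∀ {H} → Decomposition C₄ H → C4Decomposable H
Decomposition⇒C4Decomposable {H} D =
  cycles , λ x y xy → (position (piece xy) , edgeOf-position (covers xy)) , λ k k′ xy∈k xy∈k′ →
    piece-at-injective (trans (sym (unique xy (piece-at k) (edgeImage-at k xy∈k)))
                              (unique xy (piece-at k′) (edgeImage-at k′ xy∈k′)))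
  where
  open Decomposition D
  open Inverse enumeration

  cycles : List (Cycle4 H)
  cycles = tabulate (cycle ∘ embedding ∘ to)

  length≡ : length cycles ≡ #pieces
  length≡ = length-tabulate (cycle ∘ embedding ∘ to)

  piece-at : Fin (length cycles) → Piece
  piece-at k = to (cast length≡ k)

  position : Piece → Fin (length cycles)
  position p = cast (sym length≡) (from p)

  piece-at-position : ∀ p → piece-at (position p) ≡ p
  piece-at-position p = trans (cong to (cast-involutive length≡ (sym length≡) (from p))) (strictlyInverseˡ p)

  piece-at-injective : ∀ {k k′} → piece-at k ≡ piece-at k′ → k ≡ k′
  piece-at-injective {k} {k′} eq = begin
    k                                        ≡⟨ cast-involutive (sym length≡) length≡ k ⟨
    cast (sym length≡) (cast length≡ k)      ≡⟨ cong (cast (sym length≡)) (↔-injective enumeration eq) ⟩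
    cast (sym length≡) (cast length≡ k′)     ≡⟨ cast-involutive (sym length≡) length≡ k′ ⟩
    k′                                       ∎
    where open ≡-Reasoning

  lookup-cycles : ∀ k → lookup cycles k ≡ cycle (embedding (piece-at k))
  lookup-cycles k = trans (cong (lookup cycles) (sym (cast-involutive (sym length≡) length≡ k)))
                          (lookup-tabulate (cycle ∘ embedding ∘ to) (cast length≡ k))

  edgeImage-at : ∀ k {x y} → EdgeOf (lookup cycles k) x y → EdgeImage (embedding (piece-at k)) x y
  edgeImage-at k xy∈k = edgeImage _ (subst (λ c → EdgeOf c _ _) (lookup-cycles k) xy∈k)

  edgeOf-position : ∀ {p x y} → EdgeImage (embedding p) x y → EdgeOf (lookup cycles (position p)) x y
  edgeOf-position {p} xy∈p = subst (λ c → EdgeOf c _ _) (sym (trans (lookup-cycles (position p))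
                                     (cong (cycle ∘ embedding) (piece-at-position p)))) (edgeOf _ xy∈p)

C4Decomposable⇒Decomposition : ∀ {H} → Symmetric H → C4Decomposable H → Decomposition C₄ H
C4Decomposable⇒Decomposition {H} sym-H (cycles , exactly-once) = record
  { Piece        = Fin (length cycles)
  ; #pieces      = length cycles
  ; enumeration  = ↔-refl
  ; embedding    = embedding ∘ lookup cycles
  ; piece        = λ xy → proj₁ (proj₁ (exactly-once _ _ xy))
  ; covers       = λ xy → edgeImage _ (proj₂ (proj₁ (exactly-once _ _ xy)))
  ; piece-unique = λ k ab xy → proj₂ (exactly-once _ _ xy) _ k (proj₂ (proj₁ (exactly-once _ _ xy)))
                                 (edgeOf (embedding (lookup cycles k)) (image _ _ ab refl refl))
  }
  where
  embedding : Cycle4 H → Embedding C₄ H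
  embedding c = record
    { map       = vert c
    ; injective = distinct c _ _
    ; adjacent  = λ { (inj₁ refl) → edges c _ ; (inj₂ refl) → sym-H (edges c _) }
    }

record Neighbourhood (H : Graph) (v : V H) (N : Set) : Set where
  field
    neighbour           : N → V H
    is-adjacent         : ∀ n → Adj H v (neighbour n)
    index               : ∀ {y} → Adj H v y → N
    neighbour-index     : ∀ {y} (vy : Adj H v y) → neighbour (index vy) ≡ y
    neighbour-injective : ∀ {n n′} → neighbour n ≡ neighbour n′ → n ≡ n′
open Neighbourhood

⊗-neighbourhood : ∀ {G H g h N M} → Neighbourhood G g N → Neighbourhood H h M → Neighbourhood (G ⊗ H) (g , h) (N × M)
⊗-neighbourhood 𝒩 ℳ = record
  { neighbour           = λ (n , m) → neighbour 𝒩 n , neighbour ℳ m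
  ; is-adjacent         = λ (n , m) → is-adjacent 𝒩 n , is-adjacent ℳ m
  ; index               = λ (gy , hy) → index 𝒩 gy , index ℳ hy
  ; neighbour-index     = λ (gy , hy) → cong₂ _,_ (neighbour-index 𝒩 gy) (neighbour-index ℳ hy)
  ; neighbour-injective = λ e → cong₂ _,_ (neighbour-injective 𝒩 (cong proj₁ e)) (neighbour-injective ℳ (cong proj₂ e))
  }

K-neighbourhood : ∀ {m} (i : Fin (suc m)) → Neighbourhood (K (suc m)) i (Fin m)
K-neighbourhood i = record
  { neighbour           = punchIn i
  ; is-adjacent         = λ j → punchInᵢ≢i i j ∘ sym
  ; index               = punchOut
  ; neighbour-index     = punchIn-punchOut
  ; neighbour-injective = punchIn-injective i _ _
  }

prev : Fin 4 → Fin 4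
prev = next ∘ next ∘ next

C₄-neighbourhood : ∀ a → Neighbourhood C₄ a (Fin 2)
C₄-neighbourhood a = record
  { neighbour           = next-or-prev
  ; is-adjacent         = λ { 0F → inj₁ refl ; 1F → inj₂ (sym (next∘prev a)) }
  ; index               = λ { (inj₁ _) → 0F ; (inj₂ _) → 1F }
  ; neighbour-index     = λ { (inj₁ refl) → refl ; (inj₂ refl) → prev∘next _ }
  ; neighbour-injective = Fin2-injective next-or-prev (next≢prev a)
  }
  where
  next-or-prev : Fin 2 → Fin 4
  next-or-prev 0F = next a
  next-or-prev 1F = prev a

  next∘prev : ∀ a → next (prev a) ≡ a
  next∘prev 0F = refl
  next∘prev 1F = refl
  next∘prev 2F = refl
  next∘prev 3F = refl

  prev∘next : ∀ a → prev (next a) ≡ a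
  prev∘next 0F = refl
  prev∘next 1F = refl
  prev∘next 2F = refl
  prev∘next 3F = refl

  next≢prev : ∀ a → next a ≢ prev a
  next≢prev 0F ()
  next≢prev 1F ()
  next≢prev 2F ()
  next≢prev 3F ()

module Counting {F H : Graph} (D : Decomposition F H) where
  open Decomposition D

  Incidence : V H → Set
  Incidence v = Σ (Piece × V F) λ (p , a) → map (embedding p) a ≡ v

  Σ-Incidence : Σ (V H) Incidence ↔ (Piece × V F)
  Σ-Incidence = mk↔ₛ′ (λ (_ , pa , _) → pa) (λ (p , a) → map (embedding p) a , (p , a) , refl)
                      (λ _ → refl) (λ { (_ , _ , refl) → refl })

  module _ {k} (regular : ∀ a → Neighbourhood F a (Fin k)) {v N} (𝒩 : Neighbourhood H v N) where

    incidence : ∀ {p y} → EdgeImage (embedding p) v y → Incidence v × Fin k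
    incidence {p} (image a _ ab a↦ _) = ((p , a) , a↦) , index (regular a) ab

    encode : N → Incidence v × Fin k
    encode n = incidence (covers (is-adjacent 𝒩 n))

    decode : Incidence v × Fin k → N
    decode (((p , a) , a↦) , i) =
      index 𝒩 (subst (λ z → Adj H z (map (embedding p) (neighbour (regular a) i))) a↦
                 (adjacent (embedding p) (is-adjacent (regular a) i)))

    decode-encode : ∀ n → decode (encode n) ≡ n
    decode-encode n with covers (is-adjacent 𝒩 n)
    ... | image a b ab _ b↦ = neighbour-injective 𝒩
          (trans (neighbour-index 𝒩 _) (trans (cong (map (embedding _)) (neighbour-index (regular a) ab)) b↦))

    incidence-unique : ∀ p a (a↦ : map (embedding p) a ≡ v) i {y} (vy : Adj H v y) →
                       map (embedding p) (neighbour (regular a) i) ≡ y → incidence (covers vy) ≡ (((p , a) , a↦) , i)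
    incidence-unique p a a↦ i vy i↦
      with piece vy | unique vy p (image a _ (is-adjacent (regular a) i) a↦ i↦) | covers vy
    ... | _ | refl | image a′ b′ ab′ a′↦ b′↦ with injective (embedding p) (trans a′↦ (sym a↦))
    ...   | refl = cong₂ (λ e j → ((p , a) , e) , j) (uip a′↦ a↦)
                     (neighbour-injective (regular a)
                       (trans (neighbour-index (regular a) ab′) (injective (embedding p) (trans b′↦ (sym i↦)))))

    encode-decode : ∀ t → encode (decode t) ≡ t
    encode-decode t@(((p , a) , a↦) , i) = incidence-unique p a a↦ i _ (sym (neighbour-index 𝒩 _))

    degree : N ↔ (Incidence v × Fin k)
    degree = mk↔ₛ′ encode decode encode-decode decode-encode

  arcs : ∀ {k} → (∀ a → Neighbourhood F a (Fin k)) → ∀ {N : V H → Set} → (∀ v → Neighbourhood H v (N v)) →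
         Σ (V H) N ↔ ((Piece × V F) × Fin k)
  arcs regular 𝒩 =
    ↔-trans (Σ-↔ ↔-refl (degree regular (𝒩 _))) (↔-trans (↔-sym Σ-assoc) (×-cong Σ-Incidence ↔-refl))

Fin-injective : ∀ {m n} → Fin m ↔ Fin n → m ≡ n
Fin-injective m↔n = cantor-schröder-bernstein (↔-injective m↔n) (↔-injective (↔-sym m↔n))

Σ-Fin-suc : ∀ {n} (P : Fin (suc n) → Set) → Σ (Fin (suc n)) P ↔ (P zero ⊎ Σ (Fin n) (P ∘ suc))
Σ-Fin-suc P = mk↔ₛ′ (λ { (zero , p) → inj₁ p ; (suc i , p) → inj₂ (i , p) })
                    (λ { (inj₁ p) → zero , p ; (inj₂ (i , p)) → suc i , p })
                    (λ { (inj₁ _) → refl ; (inj₂ _) → refl })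
                    (λ { (zero , _) → refl ; (suc _ , _) → refl })

Fin-subset : ∀ n (P : Fin n → Set) → Decidable P → Irrelevant P → ∃ λ c → Fin c ↔ Σ (Fin n) P
Fin-subset zero P _ _ = 0 , mk↔ₛ′ (λ ()) (λ { (() , _) }) (λ { (() , _) }) (λ ())
Fin-subset (suc n) P P? irr with Fin-subset n (P ∘ suc) (P? ∘ suc) irr | P? zero
... | c , c↔P∘suc | yes p = suc c , ↔-trans +↔⊎ (↔-trans (⊎-cong 1↔P₀ c↔P∘suc) (↔-sym (Σ-Fin-suc P)))
  where
  1↔P₀ : Fin 1 ↔ P zero
  1↔P₀ = mk↔ₛ′ (λ _ → p) (λ _ → zero) (irr p) (λ { zero → refl })
... | c , c↔P∘suc | no ¬p =
  c , ↔-trans c↔P∘suc (mk↔ₛ′ (λ (i , p) → suc i , p) skip-zero skip-zero-suc (λ _ → refl))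
  where
  skip-zero : Σ (Fin (suc n)) P → Σ (Fin n) (P ∘ suc)
  skip-zero (zero , p) = ⊥-elim (¬p p)
  skip-zero (suc i , p) = i , p

  skip-zero-suc : ∀ ip → (suc (proj₁ (skip-zero ip)) , proj₂ (skip-zero ip)) ≡ ip
  skip-zero-suc (zero , p) = ⊥-elim (¬p p)
  skip-zero-suc (suc _ , _) = refl

finite-subset : ∀ {n} {A : Set} → Fin n ↔ A → (P : A → Set) → Decidable P → Irrelevant P → ∃ λ c → Fin c ↔ Σ A P
finite-subset {n} n↔A P P? irr =
  let c , c↔ = Fin-subset n (P ∘ Inverse.to n↔A) (P? ∘ Inverse.to n↔A) irr in c , ↔-trans c↔ (Σ-↔ n↔A ↔-refl)

Admissible : ℕ → ℕ → Set
Admissible m n = (n % 4 ≡ 0 × m % 2 ≡ 1) ⊎ (m % 4 ≡ 0 × n % 2 ≡ 1) ⊎ (m % 4 ≡ 1 ⊎ n % 4 ≡ 1)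

admissible? : ∀ m n → Dec (Admissible m n)
admissible? m n =
  (n % 4 ℕ.≟ 0 ×-dec m % 2 ℕ.≟ 1) ⊎-dec (m % 4 ℕ.≟ 0 ×-dec n % 2 ℕ.≟ 1) ⊎-dec (m % 4 ℕ.≟ 1 ⊎-dec n % 4 ℕ.≟ 1)

-- For m = suc a and n = suc b: the degree a b is even and 8 divides the number m n a b of arcs.
Necessary : ℕ → ℕ → Set
Necessary a b = (a * b) % 2 ≡ 0 × (suc a * suc b * (a * b)) % 8 ≡ 0

necessary? : ∀ a b → Dec (Necessary a b)
necessary? a b = (a * b) % 2 ℕ.≟ 0 ×-dec (suc a * suc b * (a * b)) % 8 ℕ.≟ 0

residues-below-8 : ∀ (i j : Fin 8) → Necessary (toℕ i) (toℕ j) → Admissible (suc (toℕ i)) (suc (toℕ j))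
residues-below-8 = toWitness
  {a? = all? λ i → all? λ j → necessary? (toℕ i) (toℕ j) →-dec admissible? (suc (toℕ i)) (suc (toℕ j))} tt

residues : ∀ r s → r ℕ.< 8 → s ℕ.< 8 → Necessary r s → Admissible (suc r) (suc s)
residues r s r<8 s<8 = subst₂ (λ r s → Necessary r s → Admissible (suc r) (suc s))
  (toℕ-fromℕ< r<8) (toℕ-fromℕ< s<8) (residues-below-8 (fromℕ< r<8) (fromℕ< s<8))

mod-suc : ∀ x y n .{{_ : NonZero n}} → x % n ≡ y % n → suc x % n ≡ suc y % n
mod-suc x y n eq = trans (%-distribˡ-+ 1 x n) (trans (cong (λ r → (1 % n + r) % n) eq) (sym (%-distribˡ-+ 1 y n)))

mod-* : ∀ x x′ y y′ n .{{_ : NonZero n}} → x % n ≡ x′ % n → y % n ≡ y′ % n → (x * y) % n ≡ (x′ * y′) % n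
mod-* x x′ y y′ n eqx eqy =
  trans (%-distribˡ-* x y n) (trans (cong₂ (λ r s → (r * s) % n) eqx eqy) (sym (%-distribˡ-* x′ y′ n)))

mod-divisor : ∀ x y d n .{{_ : NonZero d}} .{{_ : NonZero n}} → d ∣ n → x % n ≡ y % n → x % d ≡ y % d
mod-divisor x y d n d∣n eq =
  trans (sym (m∣n⇒o%n%m≡o%m d n x d∣n)) (trans (cong (_% d) eq) (m∣n⇒o%n%m≡o%m d n y d∣n))

mod-8-idem : ∀ a → a % 8 ≡ (a % 8) % 8
mod-8-idem a = sym (m%n%n≡m%n a 8)

Necessary-mod-8 : ∀ a b → Necessary a b → Necessary (a % 8) (b % 8)
Necessary-mod-8 a b (ab-even , arcs≡0) =
  trans (sym (mod-* a a′ b b′ 2 (mod-divisor a a′ 2 8 (divides 4 refl) (mod-8-idem a))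
                               (mod-divisor b b′ 2 8 (divides 4 refl) (mod-8-idem b)))) ab-even ,
  trans (sym (mod-* (suc a * suc b) (suc a′ * suc b′) (a * b) (a′ * b′) 8
               (mod-* (suc a) (suc a′) (suc b) (suc b′) 8 (mod-suc a a′ 8 (mod-8-idem a)) (mod-suc b b′ 8 (mod-8-idem b)))
               (mod-* a a′ b b′ 8 (mod-8-idem a) (mod-8-idem b)))) arcs≡0
  where
  a′ = a % 8
  b′ = b % 8

Admissible-mod-8 : ∀ m m′ n n′ → m % 8 ≡ m′ % 8 → n % 8 ≡ n′ % 8 → Admissible m′ n′ → Admissible m n
Admissible-mod-8 m m′ n n′ m≡ n≡ = λ
  { (inj₁ (n₀ , m₁))        → inj₁ (trans n≡₄ n₀ , trans m≡₂ m₁)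
  ; (inj₂ (inj₁ (m₀ , n₁))) → inj₂ (inj₁ (trans m≡₄ m₀ , trans n≡₂ n₁))
  ; (inj₂ (inj₂ (inj₁ m₁))) → inj₂ (inj₂ (inj₁ (trans m≡₄ m₁)))
  ; (inj₂ (inj₂ (inj₂ n₁))) → inj₂ (inj₂ (inj₂ (trans n≡₄ n₁)))
  }
  where
  m≡₄ = mod-divisor m m′ 4 8 (divides 2 refl) m≡
  n≡₄ = mod-divisor n n′ 4 8 (divides 2 refl) n≡
  m≡₂ = mod-divisor m m′ 2 8 (divides 4 refl) m≡
  n≡₂ = mod-divisor n n′ 2 8 (divides 4 refl) n≡

Necessary⇒Admissible : ∀ a b → Necessary a b → Admissible (suc a) (suc b)
Necessary⇒Admissible a b nec =
  Admissible-mod-8 (suc a) (suc (a % 8)) (suc b) (suc (b % 8))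
    (mod-suc a (a % 8) 8 (mod-8-idem a)) (mod-suc b (b % 8) 8 (mod-8-idem b))
    (residues (a % 8) (b % 8) (m%n<n a 8) (m%n<n b 8) (Necessary-mod-8 a b nec))

necessary-conditions : ∀ a b → Decomposition C₄ (K (suc a) ⊗ K (suc b)) → Necessary a b
necessary-conditions a b D =
  subst (λ x → x % 2 ≡ 0) (sym degree-count) (m*n%n≡0 (proj₁ incidences) 2) ,
  subst (λ x → x % 8 ≡ 0) (sym (trans arc-count (*-assoc #pieces 4 2))) (m*n%n≡0 #pieces 8)
  where
  open Decomposition D
  open Counting D
  open EquationalReasoning

  neighbourhood : ∀ v → Neighbourhood (K (suc a) ⊗ K (suc b)) v (Fin a × Fin b)
  neighbourhood (i , j) = ⊗-neighbourhood (K-neighbourhood i) (K-neighbourhood j)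

  arc-count : suc a * suc b * (a * b) ≡ #pieces * 4 * 2
  arc-count = Fin-injective (begin
    Fin (suc a * suc b * (a * b))                    ↔⟨ ↔-trans *↔× (×-cong *↔× *↔×) ⟩
    ((Fin (suc a) × Fin (suc b)) × (Fin a × Fin b))  ↔⟨ arcs C₄-neighbourhood neighbourhood ⟩
    ((Piece × Fin 4) × Fin 2)                        ↔⟨ ×-cong (×-cong enumeration ↔-refl) ↔-refl ⟨
    ((Fin #pieces × Fin 4) × Fin 2)                  ↔⟨ ↔-trans *↔× (×-cong *↔× ↔-refl) ⟨
    Fin (#pieces * 4 * 2)                            ∎)

  incidences : ∃ λ c → Fin c ↔ Incidence (0F , 0F)
  incidences = finite-subset (↔-trans *↔× (×-cong enumeration ↔-refl)) _
                 (λ (p , i) → ≡-dec Fin._≟_ Fin._≟_ (map (embedding p) i) (0F , 0F)) uip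

  degree-count : a * b ≡ proj₁ incidences * 2
  degree-count = Fin-injective (begin
    Fin (a * b)                        ↔⟨ *↔× ⟩
    (Fin a × Fin b)                    ↔⟨ degree C₄-neighbourhood (neighbourhood (0F , 0F)) ⟩
    (Incidence (0F , 0F) × Fin 2)      ↔⟨ ×-cong (proj₂ incidences) ↔-refl ⟨
    (Fin (proj₁ incidences) × Fin 2)   ↔⟨ *↔× ⟨
    Fin (proj₁ incidences * 2)         ∎)

necessity : ∀ m n → 2 ≤ m → 2 ≤ n → Decomposition C₄ (K m ⊗ K n) → Admissible m n
necessity (suc a) (suc b) _ _ = Necessary⇒Admissible a b ∘ necessary-conditions a b

-- C₄ is K₂,₂ with sides {0, 2} and {1, 3}.
corner : Fin 4 → Fin 2 ⊎ Fin 2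
corner 0F = inj₁ 0F
corner 1F = inj₂ 0F
corner 2F = inj₁ 1F
corner 3F = inj₂ 1F

uncorner : Fin 2 ⊎ Fin 2 → Fin 4
uncorner (inj₁ 0F) = 0F
uncorner (inj₂ 0F) = 1F
uncorner (inj₁ 1F) = 2F
uncorner (inj₂ 1F) = 3F

uncorner-corner : ∀ a → uncorner (corner a) ≡ a
uncorner-corner 0F = refl
uncorner-corner 1F = refl
uncorner-corner 2F = refl
uncorner-corner 3F = refl

Across : Fin 2 ⊎ Fin 2 → Fin 2 ⊎ Fin 2 → Set
Across s t = ∃ λ l → ∃ λ l′ → (s ≡ inj₁ l × t ≡ inj₂ l′) ⊎ (s ≡ inj₂ l′ × t ≡ inj₁ l)

C₄-bipartite : ∀ {a b} → Adj C₄ a b → Across (corner a) (corner b)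
C₄-bipartite {0F}     (inj₁ refl) = 0F , 0F , inj₁ (refl , refl)
C₄-bipartite {1F}     (inj₁ refl) = 1F , 0F , inj₂ (refl , refl)
C₄-bipartite {2F}     (inj₁ refl) = 1F , 1F , inj₁ (refl , refl)
C₄-bipartite {3F}     (inj₁ refl) = 0F , 1F , inj₂ (refl , refl)
C₄-bipartite {b = 0F} (inj₂ refl) = 0F , 0F , inj₂ (refl , refl)
C₄-bipartite {b = 1F} (inj₂ refl) = 1F , 0F , inj₁ (refl , refl)
C₄-bipartite {b = 2F} (inj₂ refl) = 1F , 1F , inj₂ (refl , refl)
C₄-bipartite {b = 3F} (inj₂ refl) = 0F , 1F , inj₁ (refl , refl)

corner-adjacent : ∀ l l′ → ∃ λ a → ∃ λ b → Adj C₄ a b × corner a ≡ inj₁ l × corner b ≡ inj₂ l′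
corner-adjacent 0F 0F = 0F , 1F , inj₁ refl , refl , refl
corner-adjacent 0F 1F = 0F , 3F , inj₂ refl , refl , refl
corner-adjacent 1F 0F = 2F , 1F , inj₂ refl , refl , refl
corner-adjacent 1F 1F = 2F , 3F , inj₁ refl , refl , refl

record SquareDecomposition (H : Graph) : Set₁ where
  field
    Piece                : Set
    #pieces              : ℕ
    enumeration          : Fin #pieces ↔ Piece
    left right           : Piece → Fin 2 → V H
    adjacent-sides       : ∀ p l l′ → Adj H (left p l) (right p l′)
    left-distinct        : ∀ p → left p 0F ≢ left p 1F
    right-distinct       : ∀ p → right p 0F ≢ right p 1F
    piece                : ∀ {x y} → Adj H x y → Piece
    covers               : ∀ {x y} (xy : Adj H x y) → ∃ λ l → ∃ λ l′ →
                           (left (piece xy) l ≡ x × right (piece xy) l′ ≡ y) ⊎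
                           (right (piece xy) l′ ≡ x × left (piece xy) l ≡ y)
    piece-unique         : ∀ p l l′ (xy : Adj H (left p l) (right p l′)) → piece xy ≡ p
    piece-unique-flipped : ∀ p l l′ (yx : Adj H (right p l′) (left p l)) → piece yx ≡ p

SquareDecomposition⇒Decomposition : ∀ {H} → Symmetric H → Loopless H → SquareDecomposition H → Decomposition C₄ H
SquareDecomposition⇒Decomposition {H} sym-H loopless S = record
  { Piece        = Piece
  ; #pieces      = #pieces
  ; enumeration  = enumeration
  ; embedding    = embedding
  ; piece        = piece
  ; covers       = covering
  ; piece-unique = λ p ab xy → unique-at p (C₄-bipartite ab) xy
  }
  where
  open SquareDecomposition S

  side : Piece → Fin 2 ⊎ Fin 2 → V H
  side p = [ left p , right p ]′

  left≢right : ∀ p l l′ → left p l ≢ right p l′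
  left≢right p l l′ e = loopless (subst (λ z → Adj H z (right p l′)) e (adjacent-sides p l l′))

  side-injective : ∀ p s t → side p s ≡ side p t → s ≡ t
  side-injective p (inj₁ l) (inj₁ l′) e = cong inj₁ (Fin2-injective (left p) (left-distinct p) e)
  side-injective p (inj₁ l) (inj₂ l′) e = ⊥-elim (left≢right p l l′ e)
  side-injective p (inj₂ l) (inj₁ l′) e = ⊥-elim (left≢right p l′ l (sym e))
  side-injective p (inj₂ l) (inj₂ l′) e = cong inj₂ (Fin2-injective (right p) (right-distinct p) e)

  side-adjacent : ∀ p {s t} → Across s t → Adj H (side p s) (side p t)
  side-adjacent p (l , l′ , inj₁ (refl , refl)) = adjacent-sides p l l′
  side-adjacent p (l , l′ , inj₂ (refl , refl)) = sym-H (adjacent-sides p l l′)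

  embedding : Piece → Embedding C₄ H
  embedding p = record
    { map       = side p ∘ corner
    ; injective = λ {a} {b} e → trans (sym (uncorner-corner a))
                    (trans (cong uncorner (side-injective p (corner a) (corner b) e)) (uncorner-corner b))
    ; adjacent  = side-adjacent p ∘ C₄-bipartite
    }

  unique-at : ∀ p {s t} → Across s t → (xy : Adj H (side p s) (side p t)) → piece xy ≡ p
  unique-at p (l , l′ , inj₁ (refl , refl)) xy = piece-unique p l l′ xy
  unique-at p (l , l′ , inj₂ (refl , refl)) yx = piece-unique-flipped p l l′ yx

  covering : ∀ {x y} (xy : Adj H x y) → EdgeImage (embedding (piece xy)) x y
  covering xy with covers xy
  ... | l , l′ , inj₁ (l↦ , l′↦) with corner-adjacent l l′
  ...   | a , b , ab , ca , cb = image a b ab (trans (cong (side _) ca) l↦) (trans (cong (side _) cb) l′↦)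
  covering xy | l , l′ , inj₂ (l′↦ , l↦) with corner-adjacent l l′
  ...   | a , b , ab , ca , cb = image b a (⊎-swap ab) (trans (cong (side _) cb) l′↦) (trans (cong (side _) ca) l↦)

record Finite (A : Set) : Set where
  field
    size        : ℕ
    enumeration : Fin size ↔ A
  open Inverse enumeration

  ∀? : ∀ {P : A → Set} → Decidable P → Dec (∀ x → P x)
  ∀? {P} P? = map′ (λ ∀P x → subst P (strictlyInverseˡ x) (∀P (from x))) (λ ∀P i → ∀P (to i)) (all? (P? ∘ to))

  ∃? : ∀ {P : A → Set} → Decidable P → Dec (∃ P)
  ∃? {P} P? = map′ (λ (i , p) → to i , p) (λ (x , p) → from x , subst P (sym (strictlyInverseˡ x)) p) (any? (P? ∘ to))

  _≟_ : DecidableEquality A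
  x ≟ y = map′ (↔-injective (↔-sym enumeration)) (cong from) (from x Fin.≟ from y)

Fin-finite : ∀ n → Finite (Fin n)
Fin-finite n = record { size = n ; enumeration = ↔-refl }

×-finite : ∀ {A B} → Finite A → Finite B → Finite (A × B)
×-finite 𝒜 ℬ = record
  { size = size 𝒜 * size ℬ ; enumeration = ↔-trans *↔× (×-cong (enumeration 𝒜) (enumeration ℬ)) }
  where open Finite

module FiniteCheck {F H : Graph} (finite-F : Finite (V F)) (finite-H : Finite (V H))
                   (adj-F? : ∀ a b → Dec (Adj F a b)) (adj-H? : ∀ x y → Dec (Adj H x y))
                   {k : ℕ} (embed : Fin k → V F → V H) where
  open Finite finite-F using () renaming (∀? to ∀F?; ∃? to ∃F?; _≟_ to _≟F_)
  open Finite finite-H using () renaming (∀? to ∀H?; _≟_ to _≟H_)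

  Embeds : Set
  Embeds = ∀ p a b → (embed p a ≡ embed p b → a ≡ b) × (Adj F a b → Adj H (embed p a) (embed p b))

  Covers : Set
  Covers = ∀ x y → Adj H x y → ∃ λ p → ∃ λ a → ∃ λ b → Adj F a b × embed p a ≡ x × embed p b ≡ y

  Disjoint : Set
  Disjoint = ∀ p a b → Adj F a b → ∀ p′ a′ b′ → Adj F a′ b′ →
             embed p a ≡ embed p′ a′ → embed p b ≡ embed p′ b′ → p ≡ p′

  exact-cover? : Dec (Embeds × Covers × Disjoint)
  exact-cover? =
    (all? λ p → ∀F? λ a → ∀F? λ b →
       ((embed p a ≟H embed p b) →-dec (a ≟F b)) ×-dec (adj-F? a b →-dec adj-H? _ _)) ×-dec
    (∀H? λ x → ∀H? λ y → adj-H? x y →-dec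
       (any? λ p → ∃F? λ a → ∃F? λ b → adj-F? a b ×-dec (embed p a ≟H x) ×-dec (embed p b ≟H y))) ×-dec
    (all? λ p → ∀F? λ a → ∀F? λ b → adj-F? a b →-dec
       (all? λ p′ → ∀F? λ a′ → ∀F? λ b′ → adj-F? a′ b′ →-dec
       (embed p a ≟H embed p′ a′) →-dec (embed p b ≟H embed p′ b′) →-dec (p Fin.≟ p′)))

  checked : True exact-cover? → Decomposition F H
  checked ok = record
    { Piece        = Fin k
    ; #pieces      = k
    ; enumeration  = ↔-refl
    ; embedding    = λ p → record
        { map = embed p ; injective = proj₁ (embeds p _ _) ; adjacent = proj₂ (embeds p _ _) }
    ; piece        = λ {x} {y} xy → proj₁ (covered x y xy)
    ; covers       = λ {x} {y} xy → let _ , a , b , ab , a↦ , b↦ = covered x y xy in image a b ab a↦ b↦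
    ; piece-unique = λ p {a} {b} ab xy → let _ , a′ , b′ , a′b′ , a′↦ , b′↦ = covered _ _ xy in
                       disjoint _ a′ b′ a′b′ p a b ab a′↦ b′↦
    }
    where
    embeds : Embeds
    embeds = proj₁ (toWitness ok)

    covered : Covers
    covered = proj₁ (proj₂ (toWitness ok))

    disjoint : Disjoint
    disjoint = proj₂ (proj₂ (toWitness ok))

Complete-adj? : ∀ {A} → DecidableEquality A → ∀ x y → Dec (Adj (Complete A) x y)
Complete-adj? _≟_ x y = ¬? (x ≟ y)

⊗-adj? : ∀ {G H} → (∀ x y → Dec (Adj G x y)) → (∀ x y → Dec (Adj H x y)) → ∀ x y → Dec (Adj (G ⊗ H) x y)
⊗-adj? G? H? (g , h) (g′ , h′) = G? g g′ ×-dec H? h h′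

C₄-adj? : ∀ a b → Dec (Adj C₄ a b)
C₄-adj? a b = (b Fin.≟ next a) ⊎-dec (a Fin.≟ next b)

P₃-adj? : ∀ i j → Dec (Adj P₃ i j)
P₃-adj? i j = ¬? (i Fin.≟ j) ×-dec (i Fin.≟ 0F ⊎-dec j Fin.≟ 0F)

-- The square (0,0) (1,1) (3,0) (2,1) shifted cyclically modulo 5; its edges realise each
-- nonzero difference between the layers once.
K₅⊗K₂-square : Fin 5 → Fin 4 → Fin 5 × Fin 2
K₅⊗K₂-square i j = (toℕ i + lookupᵛ (0 ∷ 1 ∷ 3 ∷ 2 ∷ []) j) mod 5 , lookupᵛ (0F ∷ 1F ∷ 0F ∷ 1F ∷ []) j

K₅⊗K₂-decomposition : Decomposition C₄ (K 5 ⊗ K 2)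
K₅⊗K₂-decomposition = FiniteCheck.checked (Fin-finite 4) (×-finite (Fin-finite 5) (Fin-finite 2))
  C₄-adj? (⊗-adj? (Complete-adj? Fin._≟_) (Complete-adj? Fin._≟_)) K₅⊗K₂-square tt

K₄-cherry : Fin 3 → Fin 3 → Fin 4
K₄-cherry = lookupᵛ ∘ lookupᵛ ((0F ∷ 1F ∷ 2F ∷ []) ∷ (3F ∷ 0F ∷ 1F ∷ []) ∷ (2F ∷ 1F ∷ 3F ∷ []) ∷ [])

K₄-decomposition : Decomposition P₃ (K 4)
K₄-decomposition = FiniteCheck.checked (Fin-finite 3) (Fin-finite 4) P₃-adj? (Complete-adj? Fin._≟_) K₄-cherry tt

Pair : ℕ → Set
Pair n = Σ (Fin n × Fin n) λ (i , j) → i Fin.< j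

pairs : ∀ n → ∃ λ c → Fin c ↔ Pair n
pairs n = finite-subset *↔× _ (λ (i , j) → i Fin.<? j) <-irrelevant

pair-≡ : ∀ {n} {i j i′ j′ : Fin n} {i<j : i Fin.< j} {i′<j′ : i′ Fin.< j′} → i ≡ i′ → j ≡ j′ →
         _≡_ {A = Pair n} ((i , j) , i<j) ((i′ , j′) , i′<j′)
pair-≡ {i = i} {j} refl refl = cong ((i , j) ,_) (<-irrelevant _ _)

order : ∀ {n} {i j : Fin n} → i ≢ j → i Fin.< j ⊎ j Fin.< i
order {i = i} {j} i≢j with <-cmp i j
... | tri< i<j _ _ = inj₁ i<j
... | tri≈ _ i≡j _ = ⊥-elim (i≢j i≡j)
... | tri> _ _ j<i = inj₂ j<i

<⇒≢ : ∀ {n} {i j : Fin n} → i Fin.< j → i ≢ j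
<⇒≢ i<j refl = <-irrefl refl i<j

edge-decomposition : ∀ n → Decomposition (K 2) (K n)
edge-decomposition n = record
  { Piece        = Pair n
  ; #pieces      = proj₁ (pairs n)
  ; enumeration  = proj₂ (pairs n)
  ; embedding    = embedding
  ; piece        = piece
  ; covers       = covers
  ; piece-unique = piece-unique
  }
  where
  endpoint : Pair n → Fin 2 → Fin n
  endpoint ((i , _) , _) 0F = i
  endpoint ((_ , j) , _) 1F = j

  embedding : Pair n → Embedding (K 2) (K n)
  embedding ij = record
    { map       = endpoint ij
    ; injective = Fin2-injective (endpoint ij) (<⇒≢ (proj₂ ij))
    ; adjacent  = λ a≢b → a≢b ∘ Fin2-injective (endpoint ij) (<⇒≢ (proj₂ ij))
    }

  piece : ∀ {x y} → x ≢ y → Pair n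
  piece x≢y with order x≢y
  ... | inj₁ x<y = (_ , _) , x<y
  ... | inj₂ y<x = (_ , _) , y<x

  covers : ∀ {x y} (x≢y : x ≢ y) → EdgeImage (embedding (piece x≢y)) x y
  covers x≢y with order x≢y
  ... | inj₁ _ = image 0F 1F (λ ()) refl refl
  ... | inj₂ _ = image 1F 0F (λ ()) refl refl

  piece-unique : ∀ ij {a b} → a ≢ b → (xy : endpoint ij a ≢ endpoint ij b) → piece xy ≡ ij
  piece-unique ij {0F} {0F} a≢b _ = ⊥-elim (a≢b refl)
  piece-unique ij {1F} {1F} a≢b _ = ⊥-elim (a≢b refl)
  piece-unique ((i , j) , i<j) {0F} {1F} _ xy with order xy
  ... | inj₁ _   = pair-≡ refl refl
  ... | inj₂ j<i = ⊥-elim (<-asym i<j j<i)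
  piece-unique ((i , j) , i<j) {1F} {0F} _ yx with order yx
  ... | inj₁ j<i = ⊥-elim (<-asym i<j j<i)
  ... | inj₂ _   = pair-≡ refl refl

SameBlock : ∀ {n} {A : Set} → Fin n × A → Fin n × A → Set
SameBlock (p , _) (q , _) = p ≡ q

blocks : ∀ n (A : Set) → Decomposition (Complete A) (Complete (Fin n × A) ∩ SameBlock)
blocks n A = record
  { Piece        = Fin n
  ; #pieces      = n
  ; enumeration  = ↔-refl
  ; embedding    = λ p → record
      { map = p ,_ ; injective = cong proj₂ ; adjacent = λ a≢b → (a≢b ∘ cong proj₂) , refl }
  ; piece        = λ {x} _ → proj₁ x
  ; covers       = λ { {p , a} {_ , b} (x≢y , refl) → image a b (x≢y ∘ cong (p ,_)) refl refl }
  ; piece-unique = λ _ _ _ → refl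
  }

-- Between blocks p < q each vertex of p is the centre of two cherries whose leaves halve q.
P₃-crossing : ∀ s → Decomposition P₃ (Complete (Fin s × Fin 4) ∩ λ x y → ¬ SameBlock x y)
P₃-crossing s = record
  { Piece        = Pair s × Fin 4 × Fin 2
  ; #pieces      = proj₁ (pairs s) * (4 * 2)
  ; enumeration  = ↔-trans *↔× (×-cong (proj₂ (pairs s)) *↔×)
  ; embedding    = embedding
  ; piece        = piece
  ; covers       = covers
  ; piece-unique = piece-unique
  }
  where
  H = Complete (Fin s × Fin 4) ∩ λ x y → ¬ SameBlock x y

  cherry : Pair s × Fin 4 × Fin 2 → Fin 3 → Fin s × Fin 4
  cherry (((p , _) , _) , c , _) zero    = p , c
  cherry (((_ , q) , _) , _ , h) (suc l) = q , combine h l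

  cherry-injective : ∀ π {a b} → cherry π a ≡ cherry π b → a ≡ b
  cherry-injective π               {zero}  {zero}   _ = refl
  cherry-injective ((_ , p<q) , _) {zero}  {suc _}  e = ⊥-elim (<⇒≢ p<q (cong proj₁ e))
  cherry-injective ((_ , p<q) , _) {suc _} {zero}   e = ⊥-elim (<⇒≢ p<q (cong proj₁ (sym e)))
  cherry-injective (_ , _ , h)     {suc l} {suc l′} e = cong suc (combine-injectiveʳ h l h l′ (cong proj₂ e))

  cherry-adjacent : ∀ π {a b} → Adj P₃ a b → Adj H (cherry π a) (cherry π b)
  cherry-adjacent π               {zero}  {zero}  (a≢b , _)      = ⊥-elim (a≢b refl)
  cherry-adjacent ((_ , p<q) , _) {zero}  {suc _} _              = <⇒≢ p<q ∘ cong proj₁ , <⇒≢ p<q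
  cherry-adjacent ((_ , p<q) , _) {suc _} {zero}  _              = <⇒≢ p<q ∘ cong proj₁ ∘ sym , <⇒≢ p<q ∘ sym
  cherry-adjacent π               {suc _} {suc _} (_ , inj₁ ())
  cherry-adjacent π               {suc _} {suc _} (_ , inj₂ ())

  embedding : Pair s × Fin 4 × Fin 2 → Embedding P₃ H
  embedding π = record { map = cherry π ; injective = cherry-injective π ; adjacent = cherry-adjacent π }

  piece : ∀ {x y} → Adj H x y → Pair s × Fin 4 × Fin 2
  piece {p , c} {q , d} (_ , p≢q) with order p≢q
  ... | inj₁ p<q = ((p , q) , p<q) , c , proj₁ (remQuot {2} 2 d)
  ... | inj₂ q<p = ((q , p) , q<p) , d , proj₁ (remQuot {2} 2 c)

  covers : ∀ {x y} (xy : Adj H x y) → EdgeImage (embedding (piece xy)) x y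
  covers {p , c} {q , d} (_ , p≢q) with order p≢q
  ... | inj₁ _ = image zero (suc _) ((λ ()) , inj₁ refl) refl (cong (q ,_) (combine-remQuot {2} 2 d))
  ... | inj₂ _ = image (suc _) zero ((λ ()) , inj₂ refl) (cong (p ,_) (combine-remQuot {2} 2 c)) refl

  piece-unique : ∀ π {a b} → Adj P₃ a b → (xy : Adj H (cherry π a) (cherry π b)) → piece xy ≡ π
  piece-unique π {zero} {zero} (a≢b , _) _ = ⊥-elim (a≢b refl)
  piece-unique π {suc _} {suc _} (_ , inj₁ ()) _
  piece-unique π {suc _} {suc _} (_ , inj₂ ()) _
  piece-unique (((p , q) , p<q) , c , h) {zero} {suc l} _ (_ , p≢q) with order p≢q
  ... | inj₁ _   = cong₂ _,_ (pair-≡ refl refl) (cong (c ,_) (cong proj₁ (remQuot-combine h l)))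
  ... | inj₂ q<p = ⊥-elim (<-asym p<q q<p)
  piece-unique (((p , q) , p<q) , c , h) {suc l} {zero} _ (_ , q≢p) with order q≢p
  ... | inj₁ q<p = ⊥-elim (<-asym p<q q<p)
  ... | inj₂ _   = cong₂ _,_ (pair-≡ refl refl) (cong (c ,_) (cong proj₁ (remQuot-combine h l)))

P₃-decomposition : ∀ s → Decomposition P₃ (Complete (Fin s × Fin 4))
P₃-decomposition s = Decomposition-split SameBlock (λ (p , _) (q , _) → p Fin.≟ q)
  (Decomposition-trans K₄-decomposition (blocks s (Fin 4))) (P₃-crossing s)

combine-distinct : ∀ {m} (h : Fin m) → combine {n = 2} h 0F ≢ combine h 1F
combine-distinct h e with combine-injectiveʳ h 0F h 1F e
... | ()

punchOut-punchIn′ : ∀ {n} (i : Fin (suc n)) {j} (i≢ : i ≢ punchIn i j) → punchOut i≢ ≡ j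
punchOut-punchIn′ i i≢ = trans (punchOut-cong i refl) (punchOut-punchIn i)

-- The 2r neighbours of x form r pairs; a pair and the two leaf copies of x span a square.
K⊗P₃-squares : ∀ r → SquareDecomposition (K (suc (r * 2)) ⊗ P₃)
K⊗P₃-squares r = record
  { Piece                = Piece
  ; #pieces              = suc (r * 2) * r
  ; enumeration          = *↔×
  ; left                 = left
  ; right                = right
  ; adjacent-sides       = λ (x , q) l l′ → punchInᵢ≢i x _ ∘ sym , (λ ()) , inj₂ refl
  ; left-distinct        = λ _ ()
  ; right-distinct       = λ (x , q) → combine-distinct q ∘ punchIn-injective x _ _ ∘ cong proj₁
  ; piece                = piece
  ; covers               = covers
  ; piece-unique         = λ (x , q) l l′ xy → cong (x ,_) (pair-mate x q l′ (proj₁ xy))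
  ; piece-unique-flipped = λ (x , q) l l′ yx → cong (x ,_) (pair-mate x q l′ (proj₁ yx ∘ sym))
  }
  where
  H = K (suc (r * 2)) ⊗ P₃
  Piece = Fin (suc (r * 2)) × Fin r

  mate : Fin (suc (r * 2)) → Fin r → Fin 2 → Fin (suc (r * 2))
  mate x q l = punchIn x (combine q l)

  left right : Piece → Fin 2 → V H
  left  (x , _) l = x , suc l
  right (x , q) l = mate x q l , 0F

  pair : ∀ {x y} → x ≢ y → Fin r × Fin 2
  pair x≢y = remQuot {r} 2 (punchOut x≢y)

  mate-pair : ∀ {x y} (x≢y : x ≢ y) → mate x (proj₁ (pair x≢y)) (proj₂ (pair x≢y)) ≡ y
  mate-pair x≢y = trans (cong (punchIn _) (combine-remQuot {r} 2 (punchOut x≢y))) (punchIn-punchOut x≢y)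

  pair-mate : ∀ x q l (x≢ : x ≢ mate x q l) → proj₁ (pair x≢) ≡ q
  pair-mate x q l x≢ = cong proj₁ (trans (cong (remQuot {r} 2) (punchOut-punchIn′ x x≢)) (remQuot-combine q l))

  piece : ∀ {u v} → Adj H u v → Piece
  piece {x , zero}  {y , _} (x≢y , _) = y , proj₁ (pair (x≢y ∘ sym))
  piece {x , suc _} {y , _} (x≢y , _) = x , proj₁ (pair x≢y)

  covers : ∀ {u v} (uv : Adj H u v) → ∃ λ l → ∃ λ l′ →
           (left (piece uv) l ≡ u × right (piece uv) l′ ≡ v) ⊎ (right (piece uv) l′ ≡ u × left (piece uv) l ≡ v)
  covers {x , zero}  {y , zero}  (_ , 0≢0 , _)          = ⊥-elim (0≢0 refl)
  covers {x , zero}  {y , suc l} (x≢y , _)               = l , _ , inj₂ (cong (_, zero) (mate-pair (x≢y ∘ sym)) , refl)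
  covers {x , suc l} {y , zero}  (x≢y , _)               = l , _ , inj₁ (refl , cong (_, zero) (mate-pair x≢y))
  covers {x , suc _} {y , suc _} (_ , _ , inj₁ ())
  covers {x , suc _} {y , suc _} (_ , _ , inj₂ ())

-- The vertices of K₄ₜ₊₁: a point ∞ and t blocks of four.
Point : ℕ → Set
Point t = ⊤ ⊎ (Fin t × Fin 4)

pattern ∞ = inj₁ tt

SameBlock∞ : ∀ {t} → Point t → Point t → Set
SameBlock∞ (inj₂ (p , _)) (inj₂ (q , _)) = p ≡ q
SameBlock∞ _              _              = ⊤

sameBlock∞? : ∀ {t} (x y : Point t) → Dec (SameBlock∞ x y)
sameBlock∞? (inj₂ (p , _)) (inj₂ (q , _)) = p Fin.≟ q
sameBlock∞? ∞              (inj₂ _)       = yes tt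
sameBlock∞? (inj₂ _)       ∞              = yes tt
sameBlock∞? ∞              ∞              = yes tt

SameBlock∞-sym : ∀ {t} {x y : Point t} → SameBlock∞ x y → SameBlock∞ y x
SameBlock∞-sym {x = inj₂ _} {inj₂ _} = sym
SameBlock∞-sym {x = inj₂ _} {∞}      = λ _ → tt
SameBlock∞-sym {x = ∞}      {inj₂ _} = λ _ → tt
SameBlock∞-sym {x = ∞}      {∞}      = λ _ → tt

module _ {t : ℕ} where
  OnPoints : (Point t → Point t → Set) → Point t × Fin 2 → Point t × Fin 2 → Set
  OnPoints R (x , _) (y , _) = R x y

  Layered : (Point t → Point t → Set) → Graph
  Layered R = (Complete (Point t) ⊗ K 2) ∩ OnPoints R

  Layered-symmetric : ∀ {R} → (∀ {x y} → R x y → R y x) → Symmetric (Layered R)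
  Layered-symmetric R-sym ((x≢y , e≢e′) , r) = (x≢y ∘ sym , e≢e′ ∘ sym) , R-sym r

  Layered-loopless : ∀ {R} → Loopless (Layered R)
  Layered-loopless ((x≢x , _) , _) = x≢x refl

  block : Fin t → Fin 5 → Point t
  block p zero    = ∞
  block p (suc c) = inj₂ (p , c)

  position : Point t → Fin 5
  position ∞              = zero
  position (inj₂ (_ , c)) = suc c

  block-injective : ∀ p {i j} → block p i ≡ block p j → i ≡ j
  block-injective p {zero}  {zero}  _    = refl
  block-injective p {suc _} {suc _} refl = refl

  blockOf : ∀ {x y : Point t} → x ≢ y → SameBlock∞ x y → Fin t
  blockOf {inj₂ (p , _)} _   _ = p
  blockOf {∞} {inj₂ (p , _)} _ _ = p
  blockOf {∞} {∞}        x≢y _ = ⊥-elim (x≢y refl)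

  block-position : ∀ {x y} (x≢y : x ≢ y) (same : SameBlock∞ x y) →
                   block (blockOf x≢y same) (position x) ≡ x × block (blockOf x≢y same) (position y) ≡ y
  block-position {inj₂ _} {inj₂ _} _   refl = refl , refl
  block-position {inj₂ _} {∞}      _   _    = refl , refl
  block-position {∞} {inj₂ _}      _   _    = refl , refl
  block-position {∞} {∞}           x≢y _    = ⊥-elim (x≢y refl)

  K₅⊗K₂-blocks : Decomposition (K 5 ⊗ K 2) (Layered SameBlock∞)
  K₅⊗K₂-blocks = record
    { Piece        = Fin t
    ; #pieces      = t
    ; enumeration  = ↔-refl
    ; embedding    = λ p → record
        { map       = λ (i , e) → block p i , e
        ; injective = λ e → cong₂ _,_ (block-injective p (cong proj₁ e)) (cong proj₂ e)
        ; adjacent  = λ {(i , _)} {(j , _)} (i≢j , e≢e′) → (i≢j ∘ block-injective p , e≢e′) , same-block p i j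
        }
    ; piece        = λ ((x≢y , _) , same) → blockOf x≢y same
    ; covers       = covers
    ; piece-unique = λ { p {zero , _} {zero , _} (i≢j , _) _ → ⊥-elim (i≢j refl)
                      ; p {zero , _} {suc _ , _} _ _ → refl
                      ; p {suc _ , _} _ _ → refl }
    }
    where
    same-block : ∀ p i j → SameBlock∞ (block p i) (block p j)
    same-block p zero    _       = tt
    same-block p (suc _) zero    = tt
    same-block p (suc _) (suc _) = refl

    covers : ∀ {u v} (uv : Adj (Layered SameBlock∞) u v) → EdgeImage _ u v
    covers {x , e} {y , e′} ((x≢y , e≢e′) , same) =
      image (position x , e) (position y , e′)
            ((λ i≡j → x≢y (trans (sym x↦) (trans (cong (block _) i≡j) y↦))) , e≢e′)
            (cong (_, e) x↦) (cong (_, e′) y↦)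
      where
      x↦ = proj₁ (block-position x≢y same)
      y↦ = proj₂ (block-position x≢y same)

-- Block p in layer 0 and block q ≠ p in layer 1 span a K₄,₄, which splits into four squares
-- by halving both blocks.
crossing-squares : ∀ t′ → SquareDecomposition (Layered {suc t′} λ x y → ¬ SameBlock∞ x y)
crossing-squares t′ = record
  { Piece                = Piece
  ; #pieces              = suc t′ * (t′ * (2 * 2))
  ; enumeration          = ↔-trans *↔× (×-cong ↔-refl (↔-trans *↔× (×-cong ↔-refl *↔×)))
  ; left                 = left
  ; right                = right
  ; adjacent-sides       = λ (p , k , _ , _) _ _ → (p≢q p k ∘ cong proj₁ ∘ inj₂-injective , λ ()) , p≢q p k
  ; left-distinct        = λ (_ , _ , h , _) → combine-distinct h ∘ cong proj₂ ∘ inj₂-injective ∘ cong proj₁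
  ; right-distinct       = λ (_ , _ , _ , h′) → combine-distinct h′ ∘ cong proj₂ ∘ inj₂-injective ∘ cong proj₁
  ; piece                = piece
  ; covers               = covers
  ; piece-unique         = λ (p , k , h , h′) l l′ _ → oriented-square p k h h′ l l′ _
  ; piece-unique-flipped = λ (p , k , h , h′) l l′ _ → oriented-square p k h h′ l l′ _
  }
  where
  H = Layered {suc t′} λ x y → ¬ SameBlock∞ x y
  Piece = Fin (suc t′) × Fin t′ × Fin 2 × Fin 2

  left right : Piece → Fin 2 → V H
  left  (p , _ , h , _)  l = inj₂ (p , combine h l) , 0F
  right (p , k , _ , h′) l = inj₂ (punchIn p k , combine h′ l) , 1F

  p≢q : ∀ p k → p ≢ punchIn p k
  p≢q p k = punchInᵢ≢i p k ∘ sym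

  oriented : ∀ {p q} → p ≢ q → Fin 4 → Fin 4 → Piece
  oriented {p} p≢q c d = p , punchOut p≢q , proj₁ (remQuot {2} 2 c) , proj₁ (remQuot {2} 2 d)

  oriented-square : ∀ p k h h′ l l′ (p≢ : p ≢ punchIn p k) →
                    oriented p≢ (combine h l) (combine h′ l′) ≡ (p , k , h , h′)
  oriented-square p k h h′ l l′ p≢ =
    cong₂ (λ k h,h′ → p , k , h,h′) (punchOut-punchIn′ p p≢)
          (cong₂ _,_ (cong proj₁ (remQuot-combine h l)) (cong proj₁ (remQuot-combine h′ l′)))

  oriented-covers : ∀ {p q} (p≢q : p ≢ q) c d →
                    left (oriented p≢q c d) (proj₂ (remQuot {2} 2 c)) ≡ (inj₂ (p , c) , 0F) ×
                    right (oriented p≢q c d) (proj₂ (remQuot {2} 2 d)) ≡ (inj₂ (q , d) , 1F)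
  oriented-covers p≢q c d =
    cong (λ c → inj₂ (_ , c) , 0F) (combine-remQuot {2} 2 c) ,
    cong₂ (λ q d → inj₂ (q , d) , 1F) (punchIn-punchOut p≢q) (combine-remQuot {2} 2 d)

  piece : ∀ {u v} → Adj H u v → Piece
  piece {inj₂ (_ , c) , 0F}     {inj₂ (_ , d) , _} (_ , p≢q) = oriented p≢q c d
  piece {inj₂ (_ , c) , 1F} {inj₂ (_ , d) , _} (_ , p≢q) = oriented (p≢q ∘ sym) d c
  piece {∞ , _}             {_}          (_ , ¬same) = ⊥-elim (¬same tt)
  piece {inj₂ _ , _}        {∞ , _}      (_ , ¬same) = ⊥-elim (¬same tt)

  covers : ∀ {u v} (uv : Adj H u v) → ∃ λ l → ∃ λ l′ →
           (left (piece uv) l ≡ u × right (piece uv) l′ ≡ v) ⊎ (right (piece uv) l′ ≡ u × left (piece uv) l ≡ v)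
  covers {inj₂ _ , 0F}     {inj₂ _ , 1F} (_ , p≢q) =
    _ , _ , inj₁ (oriented-covers p≢q _ _)
  covers {inj₂ _ , 1F} {inj₂ _ , 0F}     (_ , p≢q) =
    _ , _ , inj₂ (swap (oriented-covers (p≢q ∘ sym) _ _))
  covers {inj₂ _ , 0F}     {inj₂ _ , 0F}     ((_ , e≢e) , _) = ⊥-elim (e≢e refl)
  covers {inj₂ _ , 1F} {inj₂ _ , 1F} ((_ , e≢e) , _) = ⊥-elim (e≢e refl)
  covers {∞ , _}             {_}                 (_ , ¬same)     = ⊥-elim (¬same tt)
  covers {inj₂ _ , _}        {∞ , _}             (_ , ¬same)     = ⊥-elim (¬same tt)

Point-enumeration : ∀ t → Point t ↔ Fin (suc (t * 4))
Point-enumeration t = ↔-sym (↔-trans +↔⊎ (⊎-cong 1↔⊤ *↔×))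

K₄ₜ₊₁⊗K₂-decomposition : ∀ t′ → Decomposition C₄ (K (suc (suc t′ * 4)) ⊗ K 2)
K₄ₜ₊₁⊗K₂-decomposition t′ =
  Decomposition-trans
    (Decomposition-split (OnPoints SameBlock∞) (λ (x , _) (y , _) → sameBlock∞? x y)
      (Decomposition-trans K₅⊗K₂-decomposition K₅⊗K₂-blocks)
      (SquareDecomposition⇒Decomposition (Layered-symmetric {R = Apart} (λ ¬same → ¬same ∘ SameBlock∞-sym))
                                         (Layered-loopless {R = Apart}) (crossing-squares t′)))
    (≅⇒Decomposition (⊗-congˡ (K 2) (Complete-cong (Point-enumeration (suc t′)))))
  where
  Apart : Point (suc t′) → Point (suc t′) → Set
  Apart x y = ¬ SameBlock∞ x y

K⊗P₃-decomposition : ∀ r → Decomposition C₄ (K (suc (r * 2)) ⊗ P₃)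
K⊗P₃-decomposition r = SquareDecomposition⇒Decomposition
  (⊗-symmetric {K (suc (r * 2))} {P₃} (Complete-symmetric _) P₃-symmetric)
  (⊗-loopless {K (suc (r * 2))} P₃ (Complete-loopless _))
  (K⊗P₃-squares r)

K₂ᵣ₊₁⊗K₄ₛ-decomposition : ∀ r s → Decomposition C₄ (K (suc (r * 2)) ⊗ K (s * 4))
K₂ᵣ₊₁⊗K₄ₛ-decomposition r s =
  Decomposition-trans (K⊗P₃-decomposition r)
    (Decomposition-trans (Decomposition-⊗ (K (suc (r * 2))) (P₃-decomposition s))
                         (Decomposition-⊗ (K (suc (r * 2))) (≅⇒Decomposition (Complete-cong (↔-sym *↔×)))))

K₄ₜ₊₁⊗Kₙ-decomposition : ∀ t′ n → Decomposition C₄ (K (suc (suc t′ * 4)) ⊗ K n)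
K₄ₜ₊₁⊗Kₙ-decomposition t′ n =
  Decomposition-trans (K₄ₜ₊₁⊗K₂-decomposition t′) (Decomposition-⊗ (K (suc (suc t′ * 4))) (edge-decomposition n))

odd-form : ∀ m → m % 2 ≡ 1 → m ≡ suc (m / 2 * 2)
odd-form m m₁ = trans (m≡m%n+[m/n]*n m 2) (cong (_+ m / 2 * 2) m₁)

multiple-of-4-form : ∀ n → n % 4 ≡ 0 → n ≡ n / 4 * 4
multiple-of-4-form n n₀ = trans (m≡m%n+[m/n]*n n 4) (cong (_+ n / 4 * 4) n₀)

one-mod-4-form : ∀ m → 2 ≤ m → m % 4 ≡ 1 → ∃ λ t′ → m ≡ suc (suc t′ * 4)
one-mod-4-form m 2≤m m₁ with m / 4 | trans (m≡m%n+[m/n]*n m 4) (cong (_+ m / 4 * 4) m₁)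
... | zero   | refl = ⊥-elim (≤⇒≯ 2≤m ≤-refl)
... | suc t′ | m≡   = t′ , m≡

odd⊗multiple-of-4 : ∀ m n → m % 2 ≡ 1 → n % 4 ≡ 0 → Decomposition C₄ (K m ⊗ K n)
odd⊗multiple-of-4 m n m₁ n₀ rewrite odd-form m m₁ | multiple-of-4-form n n₀ =
  K₂ᵣ₊₁⊗K₄ₛ-decomposition (m / 2) (n / 4)

one-mod-4⊗any : ∀ m n → 2 ≤ m → m % 4 ≡ 1 → Decomposition C₄ (K m ⊗ K n)
one-mod-4⊗any m n 2≤m m₁ with one-mod-4-form m 2≤m m₁
... | t′ , refl = K₄ₜ₊₁⊗Kₙ-decomposition t′ n

sufficiency : ∀ m n → 2 ≤ m → 2 ≤ n → Admissible m n → Decomposition C₄ (K m ⊗ K n)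
sufficiency m n _   _   (inj₁ (n₀ , m₁))        = odd⊗multiple-of-4 m n m₁ n₀
sufficiency m n _   _   (inj₂ (inj₁ (m₀ , n₁))) = Decomposition-swap (odd⊗multiple-of-4 n m n₁ m₀)
sufficiency m n 2≤m _   (inj₂ (inj₂ (inj₁ m₁))) = one-mod-4⊗any m n 2≤m m₁
sufficiency m n _   2≤n (inj₂ (inj₂ (inj₂ n₁))) = Decomposition-swap (one-mod-4⊗any n m 2≤n n₁)

theorem1p1 : (m n : ℕ) → 2 ≤ m → 2 ≤ n →
    (C4Decomposable (K m ⊗ K n) ⇔
      ((n % 4 ≡ 0 × m % 2 ≡ 1)
        ⊎ (m % 4 ≡ 0 × n % 2 ≡ 1)
        ⊎ (m % 4 ≡ 1 ⊎ n % 4 ≡ 1)))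
theorem1p1 m n 2≤m 2≤n = mk⇔
  (necessity m n 2≤m 2≤n ∘ C4Decomposable⇒Decomposition K⊗K-symmetric)
  (Decomposition⇒C4Decomposable ∘ sufficiency m n 2≤m 2≤n)
  where
  K⊗K-symmetric : Symmetric (K m ⊗ K n)
  K⊗K-symmetric = ⊗-symmetric {K m} {K n} (Complete-symmetric _) (Complete-symmetric _)
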